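{- Let $x,y,a,b$ be non-negative integers such that (i) $x\ge y-1$ and $a\ge b-1$; (ii) $x+y$ is a positive odd integer; (iii) $a+b$ is a positive even integer. Then $$\big(xy+x-y^2+2y+1\big)\big(ab+a-b^2+b+1\big)\ \ge\ (x+a)(y+b)+(x+a)-(y+b)^2+2(y+b)+1.$$ -}

module Defs where

open import Data.Nat using (ℕ)
open import Data.Nat.Divisibility using (_∣_)
open import Relation.Nullary using (¬_)

Even : ℕ → Set
Even n = 2 ∣ n

Odd : ℕ → Set
Odd n = ¬ (2 ∣ n)

-- Parity and the bounds force x + 1 = y + 2p and a = b + 2q. In these parameters the first
-- factor is 2u and the second 2v + 1, where u = (p+1)(y+1) - 1 and v = (q+1)(b+1) - 1, while
-- the pair (x + a, y + b) has parameters (p + q, y + b), so the left-hand side is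
-- 2(u + qy + pb + v). It remains to see qy + pb + v ≤ 2uv: the monomials qy and pb occur in
-- uv, and v ≤ uv because u ≥ 1 (x ≥ 0 rules out p = y = 0).
module Submission where

open import Defs
open import Data.Nat using (ℕ; _<_) renaming (_+_ to _+ℕ_; _≤_ to _≤ℕ_)
open import Data.Integer using (ℤ; +_; _+_; _-_; _*_; _≤_)

open import Data.Nat using (zero; suc; _∸_; NonZero; >-nonZero; z<s) renaming (_*_ to _*ℕ_)
open import Data.Nat.Properties
  using (+-comm; +-assoc; *-comm; *-assoc; m+[n∸m]≡n; m≤m+n; m≤n+m; m≤n*m; +-mono-≤; +-monoʳ-≤;
         *-monoʳ-≤; <-≤-trans; m≤n⇒m<n∨m≡n; m<1+n⇒m≤n; even≢odd)
import Data.Nat.Properties as ℕ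
open import Data.Nat.Divisibility using (_∣_; divides; quotient; ∣m+n∣m⇒∣n; ∣m∣n⇒∣m+n; ∣-refl; m∣m*n)
open import Data.Nat.Divisibility.Core using (module _∣_)
import Data.Nat.Tactic.RingSolver as ℕ-Solver
open import Data.Integer using (+≤+)
open import Data.Integer.Properties using (pos-*)
import Data.Integer.Properties as ℤ
open import Data.Integer.Tactic.RingSolver using (solve-∀)
open import Data.Product using (∃-syntax; _,_)
open import Data.Sum using (_⊎_; inj₁; inj₂; [_,_]′; fromInj₂)
open import Function using (_∘_)
open import Relation.Binary.PropositionalEquality
  using (_≡_; refl; sym; trans; cong; cong₂; subst; module ≡-Reasoning)
open import Relation.Nullary using (contradiction)
open _∣_ using (equality)

private variable
  m n : ℕ

even⊎even-suc : ∀ n → Even n ⊎ Even (suc n)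
even⊎even-suc zero    = inj₁ (divides 0 refl)
even⊎even-suc (suc n) = [ inj₂ ∘ ∣m∣n⇒∣m+n ∣-refl , inj₁ ]′ (even⊎even-suc n)

odd⇒even-suc : Odd n → Even (suc n)
odd⇒even-suc {n} odd = fromInj₂ (λ even → contradiction even odd) (even⊎even-suc n)

odd-+-suc : ∀ n → Odd (n +ℕ suc n)
odd-+-suc n (divides k n+1+n≡k*2) = even≢odd k n (begin
  2 *ℕ k         ≡⟨ *-comm 2 k ⟩
  k *ℕ 2         ≡⟨ sym n+1+n≡k*2 ⟩
  n +ℕ suc n     ≡⟨ regroup n ⟩
  suc (2 *ℕ n)   ∎)
  where
  open ≡-Reasoning
  regroup : ∀ n → n +ℕ suc n ≡ suc (2 *ℕ n)
  regroup = ℕ-Solver.solve-∀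

even-sum⇒even-gap : n ≤ℕ m → Even (m +ℕ n) → ∃[ k ] m ≡ n +ℕ 2 *ℕ k
even-sum⇒even-gap {n} {m} n≤m 2∣m+n = quotient 2∣m∸n , (begin
  m                           ≡⟨ sym (m+[n∸m]≡n n≤m) ⟩
  n +ℕ (m ∸ n)                ≡⟨ cong (n +ℕ_) (equality 2∣m∸n) ⟩
  n +ℕ quotient 2∣m∸n *ℕ 2    ≡⟨ cong (n +ℕ_) (*-comm (quotient 2∣m∸n) 2) ⟩
  n +ℕ 2 *ℕ quotient 2∣m∸n    ∎)
  where
  open ≡-Reasoning
  regroup : ∀ n d → n +ℕ d +ℕ n ≡ 2 *ℕ n +ℕ d
  regroup = ℕ-Solver.solve-∀
  m+n≡2n+[m∸n] : m +ℕ n ≡ 2 *ℕ n +ℕ (m ∸ n)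
  m+n≡2n+[m∸n] = begin
    m +ℕ n              ≡⟨ cong (_+ℕ n) (sym (m+[n∸m]≡n n≤m)) ⟩
    n +ℕ (m ∸ n) +ℕ n   ≡⟨ regroup n (m ∸ n) ⟩
    2 *ℕ n +ℕ (m ∸ n)   ∎
  2∣m∸n : 2 ∣ m ∸ n
  2∣m∸n = ∣m+n∣m⇒∣n (subst Even m+n≡2n+[m∸n] 2∣m+n) (m∣m*n n)

odd-sum-gap : ∀ {x y} → y ≤ℕ x +ℕ 1 → Odd (x +ℕ y) → ∃[ p ] suc x ≡ y +ℕ 2 *ℕ p
odd-sum-gap {x} {y} y≤x+1 odd = even-sum⇒even-gap (subst (y ≤ℕ_) (+-comm x 1) y≤x+1) (odd⇒even-suc odd)

even-sum-gap : ∀ {a b} → b ≤ℕ a +ℕ 1 → Even (a +ℕ b) → ∃[ q ] a ≡ b +ℕ 2 *ℕ q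
even-sum-gap {a} {b} b≤a+1 even with m≤n⇒m<n∨m≡n (subst (b ≤ℕ_) (+-comm a 1) b≤a+1)
... | inj₁ b<1+a = even-sum⇒even-gap (m<1+n⇒m≤n b<1+a) even
... | inj₂ refl  = contradiction even (odd-+-suc a)

gap-+ : ∀ {x a} y p b q → suc x ≡ y +ℕ 2 *ℕ p → a ≡ b +ℕ 2 *ℕ q →
  suc (x +ℕ a) ≡ (y +ℕ b) +ℕ 2 *ℕ (p +ℕ q)
gap-+ y p b q 1+x≡y+2p a≡b+2q = trans (cong₂ _+ℕ_ 1+x≡y+2p a≡b+2q) (regroup y p b q)
  where
  regroup : ∀ y p b q → y +ℕ 2 *ℕ p +ℕ (b +ℕ 2 *ℕ q) ≡ (y +ℕ b) +ℕ 2 *ℕ (p +ℕ q)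
  regroup = ℕ-Solver.solve-∀

-- (p + 1)(y + 1) - 1, written without truncated subtraction
shiftedProduct : ℕ → ℕ → ℕ
shiftedProduct p y = p *ℕ y +ℕ y +ℕ p

shiftedProduct-positive : ∀ {x y} p → suc x ≡ y +ℕ 2 *ℕ p → 0 < shiftedProduct p y
shiftedProduct-positive {x} {y} p 1+x≡y+2p = <-≤-trans (y+p-positive y p 1+x≡y+2p) y+p≤shiftedProduct
  where
  y+p-positive : ∀ y p → suc x ≡ y +ℕ 2 *ℕ p → 0 < y +ℕ p
  y+p-positive (suc _) _       _  = z<s
  y+p-positive zero    (suc _) _  = z<s
  y+p-positive zero    zero    ()
  y+p≤shiftedProduct : y +ℕ p ≤ℕ shiftedProduct p y
  y+p≤shiftedProduct = subst (y +ℕ p ≤ℕ_) (sym (+-assoc (p *ℕ y) y p)) (m≤n+m (y +ℕ p) (p *ℕ y))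

m+o+n≤m*[1+2n] : ∀ m n {o} .{{_ : NonZero m}} → o ≤ℕ m *ℕ n → m +ℕ o +ℕ n ≤ℕ m *ℕ (1 +ℕ 2 *ℕ n)
m+o+n≤m*[1+2n] m n {o} o≤mn = begin
  m +ℕ o +ℕ n                ≤⟨ +-mono-≤ (+-monoʳ-≤ m o≤mn) (m≤n*m n m) ⟩
  m +ℕ m *ℕ n +ℕ m *ℕ n      ≡⟨ regroup m n ⟩
  m *ℕ (1 +ℕ 2 *ℕ n)         ∎
  where
  open ℕ.≤-Reasoning
  regroup : ∀ m n → m +ℕ m *ℕ n +ℕ m *ℕ n ≡ m *ℕ (1 +ℕ 2 *ℕ n)
  regroup = ℕ-Solver.solve-∀

q*y+p*b≤shiftedProduct*shiftedProduct : ∀ p q y b →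
  q *ℕ y +ℕ p *ℕ b ≤ℕ shiftedProduct p y *ℕ shiftedProduct q b
q*y+p*b≤shiftedProduct*shiftedProduct p q y b =
  subst (q *ℕ y +ℕ p *ℕ b ≤ℕ_) (sym (expand p q y b)) (m≤m+n _ _)
  where
  expand : ∀ p q y b →
    (p *ℕ y +ℕ y +ℕ p) *ℕ (q *ℕ b +ℕ b +ℕ q)
      ≡ q *ℕ y +ℕ p *ℕ b +ℕ (p *ℕ y *ℕ (q *ℕ b +ℕ b +ℕ q) +ℕ y *ℕ (q *ℕ b +ℕ b) +ℕ p *ℕ (q *ℕ b +ℕ q))
  expand = ℕ-Solver.solve-∀

shiftedProduct-+-≤ : ∀ p q y b .{{_ : NonZero (shiftedProduct p y)}} →
  shiftedProduct (p +ℕ q) (y +ℕ b) ≤ℕ shiftedProduct p y *ℕ (1 +ℕ 2 *ℕ shiftedProduct q b)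
shiftedProduct-+-≤ p q y b = begin
  shiftedProduct (p +ℕ q) (y +ℕ b)
    ≡⟨ split p q y b ⟩
  shiftedProduct p y +ℕ (q *ℕ y +ℕ p *ℕ b) +ℕ shiftedProduct q b
    ≤⟨ m+o+n≤m*[1+2n] _ _ (q*y+p*b≤shiftedProduct*shiftedProduct p q y b) ⟩
  shiftedProduct p y *ℕ (1 +ℕ 2 *ℕ shiftedProduct q b)
    ∎
  where
  open ℕ.≤-Reasoning
  split : ∀ p q y b →
    (p +ℕ q) *ℕ (y +ℕ b) +ℕ (y +ℕ b) +ℕ (p +ℕ q)
      ≡ (p *ℕ y +ℕ y +ℕ p) +ℕ (q *ℕ y +ℕ p *ℕ b) +ℕ (q *ℕ b +ℕ b +ℕ q)
  split = ℕ-Solver.solve-∀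

oddQuadratic : ℤ → ℤ → ℤ
oddQuadratic x y = x * y + x - y * y + + 2 * y + + 1

evenQuadratic : ℤ → ℤ → ℤ
evenQuadratic a b = a * b + a - b * b + b + + 1

-- Stated unfolded because the ring solver does not unfold definitions.
oddQuadratic-at-y+2p-1 : ∀ y p → let x = y + + 2 * p - + 1 in
  x * y + x - y * y + + 2 * y + + 1 ≡ + 2 * (p * y + y + p)
oddQuadratic-at-y+2p-1 = solve-∀

evenQuadratic-at-b+2q : ∀ b q → let a = b + + 2 * q in
  a * b + a - b * b + b + + 1 ≡ + 1 + + 2 * (q * b + b + q)
evenQuadratic-at-b+2q = solve-∀

+[2*shiftedProduct] : ∀ p y → + (2 *ℕ shiftedProduct p y) ≡ + 2 * (+ p * + y + + y + + p)
+[2*shiftedProduct] p y =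
  trans (pos-* 2 (shiftedProduct p y)) (cong (λ z → + 2 * (z + + y + + p)) (pos-* p y))

oddQuadratic≡2*shiftedProduct : ∀ {x y} p → suc x ≡ y +ℕ 2 *ℕ p →
  oddQuadratic (+ x) (+ y) ≡ + (2 *ℕ shiftedProduct p y)
oddQuadratic≡2*shiftedProduct {x} {y} p 1+x≡y+2p = begin
  oddQuadratic (+ suc x - + 1) (+ y)          ≡⟨ cong (λ z → oddQuadratic (z - + 1) (+ y)) +[1+x]≡+y+2+p ⟩
  oddQuadratic (+ y + + 2 * + p - + 1) (+ y)  ≡⟨ oddQuadratic-at-y+2p-1 (+ y) (+ p) ⟩
  + 2 * (+ p * + y + + y + + p)               ≡⟨ sym (+[2*shiftedProduct] p y) ⟩
  + (2 *ℕ shiftedProduct p y)                 ∎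
  where
  open ≡-Reasoning
  +[1+x]≡+y+2+p : + suc x ≡ + y + + 2 * + p
  +[1+x]≡+y+2+p = trans (cong +_ 1+x≡y+2p) (cong (λ z → + y + z) (pos-* 2 p))

evenQuadratic≡1+2*shiftedProduct : ∀ {a b} q → a ≡ b +ℕ 2 *ℕ q →
  evenQuadratic (+ a) (+ b) ≡ + (1 +ℕ 2 *ℕ shiftedProduct q b)
evenQuadratic≡1+2*shiftedProduct {a} {b} q a≡b+2q = begin
  evenQuadratic (+ a) (+ b)               ≡⟨ cong (λ z → evenQuadratic z (+ b)) +a≡+b+2+q ⟩
  evenQuadratic (+ b + + 2 * + q) (+ b)   ≡⟨ evenQuadratic-at-b+2q (+ b) (+ q) ⟩
  + 1 + + 2 * (+ q * + b + + b + + q)     ≡⟨ cong (λ z → + 1 + z) (sym (+[2*shiftedProduct] q b)) ⟩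
  + (1 +ℕ 2 *ℕ shiftedProduct q b)        ∎
  where
  open ≡-Reasoning
  +a≡+b+2+q : + a ≡ + b + + 2 * + q
  +a≡+b+2+q = trans (cong +_ a≡b+2q) (cong (λ z → + b + z) (pos-* 2 q))

proposition3p1 : (x y a b : ℕ) →
    y ≤ℕ x +ℕ 1 → b ≤ℕ a +ℕ 1 →
    0 < x +ℕ y → Odd (x +ℕ y) →
    0 < a +ℕ b → Even (a +ℕ b) →
    (+ (x +ℕ a)) * (+ (y +ℕ b)) + (+ (x +ℕ a)) - (+ (y +ℕ b)) * (+ (y +ℕ b)) + + 2 * (+ (y +ℕ b)) + + 1
      ≤ ((+ x) * (+ y) + (+ x) - (+ y) * (+ y) + + 2 * (+ y) + + 1) * ((+ a) * (+ b) + (+ a) - (+ b) * (+ b) + (+ b) + + 1)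
proposition3p1 x y a b y≤x+1 b≤a+1 _ x+y-odd _ a+b-even
  with p , 1+x≡y+2p ← odd-sum-gap y≤x+1 x+y-odd
  with q , a≡b+2q ← even-sum-gap b≤a+1 a+b-even = begin
    oddQuadratic (+ (x +ℕ a)) (+ (y +ℕ b))  ≡⟨ oddQuadratic≡2*shiftedProduct (p +ℕ q) (gap-+ y p b q 1+x≡y+2p a≡b+2q) ⟩
    + (2 *ℕ shiftedProduct (p +ℕ q) (y +ℕ b)) ≤⟨ +≤+ (*-monoʳ-≤ 2 (shiftedProduct-+-≤ p q y b {{u≢0}})) ⟩
    + (2 *ℕ (u *ℕ w))                        ≡⟨ cong +_ (sym (*-assoc 2 u w)) ⟩
    + (2 *ℕ u *ℕ w)                          ≡⟨ pos-* (2 *ℕ u) w ⟩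
    + (2 *ℕ u) * + w                         ≡⟨ sym (cong₂ _*_ (oddQuadratic≡2*shiftedProduct p 1+x≡y+2p)
                                                                (evenQuadratic≡1+2*shiftedProduct q a≡b+2q)) ⟩
    oddQuadratic (+ x) (+ y) * evenQuadratic (+ a) (+ b) ∎
  where
  open ℤ.≤-Reasoning
  u w : ℕ
  u = shiftedProduct p y
  w = 1 +ℕ 2 *ℕ shiftedProduct q b
  u≢0 : NonZero u
  u≢0 = >-nonZero (shiftedProduct-positive p 1+x≡y+2p)
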